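{- Let $\sigma$ be a permutation (in one-line notation). (a) If $\sigma$ has a double descent $\sigma_{i-1}>\sigma_i>\sigma_{i+1}$, then $\varphi_{\sigma_i}(\sigma)$ is lexicographically strictly smaller than $\sigma$. (b) If $\sigma$ has no double descent and there exist pinnacles $k$ of $\sigma$ with $\min(\beta_k)>\min(\gamma_k)$, and $\ell$ is the smallest such pinnacle, then $\varphi_\ell(\sigma)$ is lexicographically strictly smaller than $\sigma$.
   Context: A pinnacle of $\sigma=\sigma_1\cdots\sigma_m$ is a value $\sigma_i$ with $1<i<m$ and $\sigma_{i-1}<\sigma_i>\sigma_{i+1}$. A double descent is a position $i$ with $1<i<m$ and $\sigma_{i-1}>\sigma_i>\sigma_{i+1}$. For a letter $k$ of $\sigma$, write $\sigma=\alpha\,\beta_k\,k\,\gamma_k\,\delta$ where $\beta_k$ (resp. $\gamma_k$) is the longest contiguous factor immediately to the left (resp. right) of $k$ all of whose letters are smaller than $k$ (possibly empty). Define $\varphi_k(\sigma)=\alpha\,\gamma_k\,k\,\beta_k\,\delta$. Lexicographic order compares one-line words letter by letter. -}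

module Defs where

open import Data.Nat using (ℕ; zero; suc; _<_; _<?_; _⊓_; _≟_)
open import Data.Bool using (Bool; true; false)
open import Data.List using (List; []; _∷_; _++_; reverse; takeWhile; dropWhile; foldr; upTo; map)
open import Data.List.Relation.Binary.Permutation.Propositional using (_↭_)
open import Data.List.Relation.Binary.Lex.Strict using (Lex-<)
open import Data.Product using (Σ; ∃; _×_; _,_)
open import Data.Maybe using (Maybe; just; nothing)
open import Relation.Binary.PropositionalEquality using (_≡_)
open import Relation.Nullary.Decidable using (does)

IsPerm : ℕ → List ℕ → Set
IsPerm n σ = σ ↭ map suc (upTo n)

_<lex_ : List ℕ → List ℕ → Set
_<lex_ = Lex-< _≡_ _<_

DoubleDescentAt : List ℕ → ℕ → Set
DoubleDescentAt σ b = ∃ λ α → ∃ λ a → ∃ λ c → ∃ λ δ →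
  (σ ≡ α ++ a ∷ b ∷ c ∷ δ) × (b < a) × (c < b)

HasDoubleDescent : List ℕ → Set
HasDoubleDescent σ = ∃ λ b → DoubleDescentAt σ b

IsPinnacle : List ℕ → ℕ → Set
IsPinnacle σ k = ∃ λ α → ∃ λ a → ∃ λ c → ∃ λ δ →
  (σ ≡ α ++ a ∷ k ∷ c ∷ δ) × (a < k) × (c < k)

splitAt : ℕ → List ℕ → Maybe (List ℕ × List ℕ)
splitAt k [] = nothing
splitAt k (x ∷ xs) with does (x ≟ k)
... | true = just ([] , xs)
... | false with splitAt k xs
...   | nothing = nothing
...   | just (p , q) = just (x ∷ p , q)

-- the factors of σ = α β_k k γ_k δ (first occurrence of k; σ has distinct letters)
-- result: (α , β_k , γ_k , δ); if k does not occur, all empty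
decomp : ℕ → List ℕ → List ℕ × List ℕ × List ℕ × List ℕ
decomp k σ with splitAt k σ
... | nothing = [] , [] , [] , []
... | just (pre , post) =
  reverse (dropWhile (λ x → x <? k) (reverse pre)) ,
  reverse (takeWhile (λ x → x <? k) (reverse pre)) ,
  takeWhile (λ x → x <? k) post ,
  dropWhile (λ x → x <? k) post

β : ℕ → List ℕ → List ℕ
β k σ with decomp k σ
... | _ , b , _ , _ = b

γ : ℕ → List ℕ → List ℕ
γ k σ with decomp k σ
... | _ , _ , g , _ = g

φ : ℕ → List ℕ → List ℕ
φ k σ with splitAt k σ | decomp k σ
... | nothing | _ = σ
... | just _ | a , b , g , d = a ++ g ++ k ∷ b ++ d

-- minimum of a list (only applied to nonempty lists; min [] = 0 is a dummy)
minL : List ℕ → ℕ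
minL [] = 0
minL (x ∷ xs) = foldr _⊓_ x xs

GoodPinnacle : List ℕ → ℕ → Set
GoodPinnacle σ k = IsPinnacle σ k × (minL (γ k σ) < minL (β k σ))

-- At a double descent a b c the factor β_b is empty and γ_b starts with c < b, so φ_b writes
-- c where σ has b.  At a pinnacle ℓ with right neighbour c, φ_ℓ writes c where σ has the
-- first letter of β_ℓ (or ℓ), so it suffices that c = min γ_ℓ, for then c < min β_ℓ.
-- Suppose instead a later letter m of γ_ℓ is below c, and let p be the largest letter of γ_ℓ
-- before m.  Either p follows ℓ directly, and then p is a double descent, or p is a
-- pinnacle with β_p inside γ_ℓ (so min β_p > m) and m ∈ γ_p: a good pinnacle p < ℓ,
-- contradicting the minimality of ℓ.
module Submission where

open import Defs
open import Data.Nat using (ℕ; _≤_; _<_; _<?_; _≟_)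
open import Data.Nat.Properties
  using (≤-refl; ≤-trans; <-≤-trans; ≤-<-trans; <-asym; <⇒≱; ≤∧≢⇒<; ≤-<-connex;
         m⊓n≤m; m⊓n≤n; ⊓-glb; suc-injective)
open import Data.List
  using (List; []; _∷_; _++_; _∷ʳ_; reverse; takeWhile; dropWhile)
open import Data.List.Properties
  using (++-assoc; ++-identityʳ; ∷ʳ-++; reverse-++; unfold-reverse; reverse-involutive;
         takeWhile++dropWhile; foldr-forcesᵇ; foldr-preservesᵇ; foldr-preservesʳ)
open import Data.List.Relation.Unary.All as All using (All; []; _∷_)
open import Data.List.Relation.Unary.All.Properties using (++⁻; ++⁻ˡ; ++⁻ʳ; all-takeWhile)
import Data.List.Relation.Unary.First as First
open import Data.List.Relation.Unary.First.Properties using (toView)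
open import Data.List.Relation.Unary.Unique.Propositional using (Unique)
open import Data.List.Relation.Unary.AllPairs using (_∷_)
open import Data.List.Relation.Unary.Unique.Propositional.Properties using (map⁺; upTo⁺)
open import Data.List.Relation.Binary.Lex.Strict using (this; next)
open import Data.List.Relation.Binary.Permutation.Propositional using (↭-sym; ↭⇒↭ₛ)
open import Data.List.Relation.Binary.Permutation.Propositional.Properties using (All-resp-↭; ↭-reverse)
open import Relation.Binary.PropositionalEquality
  using (_≡_; _≢_; refl; sym; trans; cong; cong₂; subst; subst₂; setoid; module ≡-Reasoning)
open import Data.List.Relation.Binary.Permutation.Setoid.Properties (setoid ℕ) using (Unique-resp-↭)
open import Data.List.Membership.Propositional using (_∈_)
open import Data.List.Membership.Propositional.Properties using (∈-∃++)
open import Data.List.Relation.Unary.Any using (here; there)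
open import Data.List.Extrema.Nat using (max; argmax-sel; xs≤max; v≤max⁺)
open import Data.Maybe using (just)
open import Data.Product using (∃-syntax; _×_; _,_; proj₁; proj₂; uncurry)
open import Data.Sum using (_⊎_; inj₁; inj₂; [_,_]′)
open import Data.Empty using (⊥-elim)
open import Function using (_∘_; id)
open import Relation.Nullary using (¬_)
open import Relation.Nullary.Decidable using (dec-true; dec-false)
open import Relation.Unary using (Pred; Decidable)

open ≡-Reasoning

IsPerm⇒Unique : ∀ {n σ} → IsPerm n σ → Unique σ
IsPerm⇒Unique {n} σ↭ =
  Unique-resp-↭ (↭⇒↭ₛ (↭-sym σ↭)) (map⁺ suc-injective (upTo⁺ n))

Unique-++-∷⁻ : ∀ (xs : List ℕ) {k ys} → Unique (xs ++ k ∷ ys) → All (_≢ k) xs × All (k ≢_) ys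
Unique-++-∷⁻ []       (k∉ys ∷ _) = [] , k∉ys
Unique-++-∷⁻ (x ∷ xs) (x∉ ∷ u)   =
  All.head (++⁻ʳ xs x∉) ∷ proj₁ (Unique-++-∷⁻ xs u) , proj₂ (Unique-++-∷⁻ xs u)

splitAt-++-∷ : ∀ {k} (xs ys : List ℕ) → All (_≢ k) xs → splitAt k (xs ++ k ∷ ys) ≡ just (xs , ys)
splitAt-++-∷ {k} []       ys _ rewrite dec-true (k ≟ k) refl = refl
splitAt-++-∷ {k} (x ∷ xs) ys (x≢k ∷ xs≢k)
  rewrite dec-false (x ≟ k) x≢k | splitAt-++-∷ xs ys xs≢k = refl

splitAt-unique : ∀ {σ k} (pre post : List ℕ) → Unique σ → σ ≡ pre ++ k ∷ post →
  splitAt k σ ≡ just (pre , post)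
splitAt-unique pre post u refl = splitAt-++-∷ pre post (proj₁ (Unique-++-∷⁻ pre u))

module _ {p} {P : Pred ℕ p} (P? : Decidable P) where

  takeWhile-++ : ∀ {xs} ys → All P xs → takeWhile P? (xs ++ ys) ≡ xs ++ takeWhile P? ys
  takeWhile-++ ys []                      = refl
  takeWhile-++ ys (_∷_ {x} px pxs) rewrite dec-true (P? x) px = cong (x ∷_) (takeWhile-++ ys pxs)

  takeWhile-++-∷ : ∀ {xs y} ys → All P xs → ¬ P y → takeWhile P? (xs ++ y ∷ ys) ≡ xs
  takeWhile-++-∷ {xs} {y} ys pxs ¬py
    rewrite takeWhile-++ (y ∷ ys) pxs | dec-false (P? y) ¬py = ++-identityʳ xs

smallSuffix : ℕ → List ℕ → List ℕ
smallSuffix k xs = reverse (takeWhile (_<? k) (reverse xs))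

dropSmallSuffix : ℕ → List ℕ → List ℕ
dropSmallSuffix k xs = reverse (dropWhile (_<? k) (reverse xs))

dropSmallSuffix++smallSuffix : ∀ k xs → dropSmallSuffix k xs ++ smallSuffix k xs ≡ xs
dropSmallSuffix++smallSuffix k xs = begin
  reverse (dropWhile (_<? k) (reverse xs)) ++ reverse (takeWhile (_<? k) (reverse xs))
    ≡⟨ reverse-++ (takeWhile (_<? k) (reverse xs)) _ ⟨
  reverse (takeWhile (_<? k) (reverse xs) ++ dropWhile (_<? k) (reverse xs))
    ≡⟨ cong reverse (takeWhile++dropWhile (_<? k) (reverse xs)) ⟩
  reverse (reverse xs)
    ≡⟨ reverse-involutive xs ⟩
  xs ∎

smallSuffix-++-∷ : ∀ {k y} xs ys → ¬ y < k → All (_< k) ys → smallSuffix k (xs ++ y ∷ ys) ≡ ys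
smallSuffix-++-∷ {k} {y} xs ys y≮k ys<k = begin
  reverse (takeWhile (_<? k) (reverse (xs ++ y ∷ ys)))
    ≡⟨ cong (reverse ∘ takeWhile (_<? k)) reverse-xs++y∷ys ⟩
  reverse (takeWhile (_<? k) (reverse ys ++ y ∷ reverse xs))
    ≡⟨ cong reverse (takeWhile-++-∷ (_<? k) (reverse xs) (All-resp-↭ (↭-sym (↭-reverse ys)) ys<k) y≮k) ⟩
  reverse (reverse ys)
    ≡⟨ reverse-involutive ys ⟩
  ys ∎
  where
  reverse-xs++y∷ys : reverse (xs ++ y ∷ ys) ≡ reverse ys ++ y ∷ reverse xs
  reverse-xs++y∷ys = begin
    reverse (xs ++ y ∷ ys)        ≡⟨ reverse-++ xs (y ∷ ys) ⟩
    reverse (y ∷ ys) ++ reverse xs ≡⟨ cong (_++ reverse xs) (unfold-reverse y ys) ⟩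
    (reverse ys ∷ʳ y) ++ reverse xs ≡⟨ ∷ʳ-++ (reverse ys) y (reverse xs) ⟩
    reverse ys ++ y ∷ reverse xs  ∎

-- The paper's factorisation σ = α β_k k γ_k δ, with α = dropSmallSuffix k pre and
-- δ = dropWhile (_<? k) post.
module _ {k σ pre post} (split : splitAt k σ ≡ just (pre , post)) where

  β-split : β k σ ≡ smallSuffix k pre
  β-split rewrite split = refl

  γ-split : γ k σ ≡ takeWhile (_<? k) post
  γ-split rewrite split = refl

  φ-split : φ k σ ≡ dropSmallSuffix k pre ++ γ k σ ++ k ∷ β k σ ++ dropWhile (_<? k) post
  φ-split rewrite split = refl

  σ-split : σ ≡ pre ++ k ∷ post →
    σ ≡ dropSmallSuffix k pre ++ β k σ ++ k ∷ γ k σ ++ dropWhile (_<? k) post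
  σ-split σ≡ = begin
    σ                                              ≡⟨ σ≡ ⟩
    pre ++ k ∷ post
      ≡⟨ cong₂ (λ u v → u ++ k ∷ v) (dropSmallSuffix++smallSuffix k pre)
                                     (takeWhile++dropWhile (_<? k) post) ⟨
    (dropSmallSuffix k pre ++ smallSuffix k pre) ++ k ∷ takeWhile (_<? k) post ++ dropWhile (_<? k) post
      ≡⟨ ++-assoc (dropSmallSuffix k pre) _ _ ⟩
    dropSmallSuffix k pre ++ smallSuffix k pre ++ k ∷ takeWhile (_<? k) post ++ dropWhile (_<? k) post
      ≡⟨ cong₂ (λ b g → dropSmallSuffix k pre ++ b ++ k ∷ g ++ dropWhile (_<? k) post) β-split γ-split ⟨
    dropSmallSuffix k pre ++ β k σ ++ k ∷ γ k σ ++ dropWhile (_<? k) post ∎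

exchange-<lex : ∀ {c k} P B G D → c < k → All (c <_) B →
  (P ++ (c ∷ G) ++ k ∷ B ++ D) <lex (P ++ B ++ k ∷ (c ∷ G) ++ D)
exchange-<lex []      []      G D c<k _          = this c<k
exchange-<lex []      (b ∷ B) G D _   (c<b ∷ _)  = this c<b
exchange-<lex (x ∷ P) B       G D c<k c<B        = next refl (exchange-<lex P B G D c<k c<B)

φ-<lex : ∀ {σ k c G} pre post → Unique σ → σ ≡ pre ++ k ∷ post →
  γ k σ ≡ c ∷ G → c < k → All (c <_) (β k σ) → φ k σ <lex σ
φ-<lex {σ} {k} {c} {G} pre post u σ≡ γ≡ c<k c<β =
  subst₂ _<lex_ (sym (φ-split {σ = σ} split)) (sym (σ-split {σ = σ} split σ≡)) exchanged
  where
  split : splitAt k σ ≡ just (pre , post)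
  split = splitAt-unique pre post u σ≡
  exchanged : (dropSmallSuffix k pre ++ γ k σ ++ k ∷ β k σ ++ dropWhile (_<? k) post)
         <lex (dropSmallSuffix k pre ++ β k σ ++ k ∷ γ k σ ++ dropWhile (_<? k) post)
  exchanged rewrite γ≡ = exchange-<lex (dropSmallSuffix k pre) (β k σ) G _ c<k c<β

minL-≤ : ∀ xs → All (minL xs ≤_) xs
minL-≤ []       = []
minL-≤ (x ∷ xs) =
  foldr-preservesʳ {P = _≤ x} (λ y m≤x → ≤-trans (m⊓n≤n y _) m≤x) ≤-refl xs ∷
  foldr-forcesᵇ {P = minL (x ∷ xs) ≤_}
    (λ a b m≤a⊓b → ≤-trans m≤a⊓b (m⊓n≤m a b) , ≤-trans m≤a⊓b (m⊓n≤n a b)) x xs ≤-refl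

minL-glb : ∀ {c x xs} → All (c ≤_) (x ∷ xs) → c ≤ minL (x ∷ xs)
minL-glb {c} (c≤x ∷ c≤xs) = foldr-preservesᵇ {P = c ≤_} ⊓-glb c≤x c≤xs

maxSplit : ∀ x xs → ∃[ u ] ∃[ p ] ∃[ v ] (x ∷ xs ≡ u ++ p ∷ v × All (_≤ p) u × All (_≤ p) v)
maxSplit x xs =
  let u , v , x∷xs≡ = ∈-∃++ max∈x∷xs
      u≤p , p∷v≤p = ++⁻ u (subst (All (_≤ max x xs)) x∷xs≡ x∷xs≤max)
  in u , max x xs , v , x∷xs≡ , u≤p , All.tail p∷v≤p
  where
  max∈x∷xs : max x xs ∈ x ∷ xs
  max∈x∷xs = [ here , there ]′ (argmax-sel id x xs)

  x∷xs≤max : All (_≤ max x xs) (x ∷ xs)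
  x∷xs≤max = v≤max⁺ x xs (inj₁ ≤-refl) ∷ xs≤max x xs

all≤⊎first< : ∀ c xs → All (c ≤_) xs ⊎ ∃[ u ] ∃[ m ] ∃[ v ] (xs ≡ u ++ m ∷ v × All (c ≤_) u × m < c)
all≤⊎first< c xs with First.first (≤-<-connex c) xs
... | inj₂ c≤xs = inj₁ c≤xs
... | inj₁ c≰xs with toView c≰xs
...   | First._++_∷_ c≤u m<c v = inj₂ (_ , _ , v , refl , c≤u , m<c)

head-++-∷ : ∀ {q} {P : Pred ℕ q} G {m R} → All P G → P m → ∃[ z ] ∃[ r ] (G ++ m ∷ R ≡ z ∷ r × P z)
head-++-∷ []      {m} {R} _          pm = m , R , refl , pm
head-++-∷ (g ∷ G) {m} {R} (pg ∷ _)   _  = g , G ++ m ∷ R , refl , pg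

snocView : ∀ (x : ℕ) xs → ∃[ ys ] ∃[ y ] x ∷ xs ≡ ys ∷ʳ y
snocView x []        = [] , x , refl
snocView x (x′ ∷ xs) =
  let ys , y , x′∷xs≡ = snocView x′ xs in x ∷ ys , y , cong (x ∷_) x′∷xs≡

-- If B is empty, ℓ p and the next letter form a double descent; otherwise p is a pinnacle
-- with β_p = B and m ∈ γ_p.
peak⇒doubleDescent⊎goodPinnacle : ∀ {σ ℓ p m} X B G R → Unique σ →
  σ ≡ X ++ ℓ ∷ B ++ p ∷ G ++ m ∷ R → p < ℓ → m < p →
  All (_≤ p) B → All (_≤ p) G → All (m <_) B →
  DoubleDescentAt σ p ⊎ GoodPinnacle σ p
peak⇒doubleDescent⊎goodPinnacle {σ} {ℓ} {p} {m} X B G R u σ≡ p<ℓ m<p B≤p G≤p m<B =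
  conclude B σ≡ B<p m<B β≡ (head-++-∷ G G<p m<p)
  where
  σ≡pre : σ ≡ (X ++ ℓ ∷ B) ++ p ∷ G ++ m ∷ R
  σ≡pre = trans σ≡ (sym (++-assoc X (ℓ ∷ B) _))

  p-distinct : All (_≢ p) (X ++ ℓ ∷ B) × All (p ≢_) (G ++ m ∷ R)
  p-distinct = Unique-++-∷⁻ (X ++ ℓ ∷ B) (subst Unique σ≡pre u)

  B<p : All (_< p) B
  B<p = All.zipWith (uncurry ≤∧≢⇒<) (B≤p , All.tail (++⁻ʳ X (proj₁ p-distinct)))

  G<p : All (_< p) G
  G<p = All.zipWith (uncurry ≤∧≢⇒<) (G≤p , All.map (_∘ sym) (proj₁ (++⁻ G (proj₂ p-distinct))))

  split : splitAt p σ ≡ just (X ++ ℓ ∷ B , G ++ m ∷ R)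
  split = splitAt-unique (X ++ ℓ ∷ B) (G ++ m ∷ R) u σ≡pre

  β≡ : β p σ ≡ B
  β≡ = trans (β-split {σ = σ} split) (smallSuffix-++-∷ X B (<-asym p<ℓ) B<p)

  γ≡ : γ p σ ≡ G ++ m ∷ takeWhile (_<? p) R
  γ≡ = begin
    γ p σ                                       ≡⟨ γ-split {σ = σ} split ⟩
    takeWhile (_<? p) (G ++ m ∷ R)              ≡⟨ takeWhile-++ (_<? p) (m ∷ R) G<p ⟩
    G ++ takeWhile (_<? p) (m ∷ R)              ≡⟨ cong (G ++_) (takeWhile-++ (_<? p) R (m<p ∷ [])) ⟩
    G ++ m ∷ takeWhile (_<? p) R                ∎

  minγ≤m : minL (γ p σ) ≤ m
  minγ≤m = subst (λ g → minL g ≤ m) (sym γ≡) (All.head (++⁻ʳ G (minL-≤ (G ++ m ∷ _))))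

  conclude : ∀ B′ → σ ≡ X ++ ℓ ∷ B′ ++ p ∷ G ++ m ∷ R → All (_< p) B′ → All (m <_) B′ →
    β p σ ≡ B′ → ∃[ z ] ∃[ r ] (G ++ m ∷ R ≡ z ∷ r × z < p) →
    DoubleDescentAt σ p ⊎ GoodPinnacle σ p
  conclude [] σ≡′ _ _ _ (z , r , G++m∷R≡ , z<p) =
    inj₁ (X , ℓ , z , r , trans σ≡′ (cong (λ t → X ++ ℓ ∷ p ∷ t) G++m∷R≡) , p<ℓ , z<p)
  conclude (b ∷ B′) σ≡′ B′<p m<B′ β≡′ (z , r , G++m∷R≡ , z<p) with snocView b B′
  ... | ys , y , b∷B′≡ =
    inj₂ ((X ++ ℓ ∷ ys , y , z , r , σ≡pinnacle , y<p , z<p) , ≤-<-trans minγ≤m m<minβ)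
    where
    y<p : y < p
    y<p = All.head (++⁻ʳ ys (subst (All (_< p)) b∷B′≡ B′<p))

    σ≡pinnacle : σ ≡ (X ++ ℓ ∷ ys) ++ y ∷ p ∷ z ∷ r
    σ≡pinnacle = begin
      σ                                    ≡⟨ σ≡′ ⟩
      X ++ ℓ ∷ (b ∷ B′) ++ p ∷ G ++ m ∷ R  ≡⟨ cong (λ t → X ++ ℓ ∷ (b ∷ B′) ++ p ∷ t) G++m∷R≡ ⟩
      X ++ ℓ ∷ (b ∷ B′) ++ p ∷ z ∷ r       ≡⟨ cong (λ t → X ++ ℓ ∷ t ++ p ∷ z ∷ r) b∷B′≡ ⟩
      X ++ ℓ ∷ (ys ∷ʳ y) ++ p ∷ z ∷ r      ≡⟨ cong (λ t → X ++ ℓ ∷ t) (∷ʳ-++ ys y _) ⟩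
      X ++ ℓ ∷ ys ++ y ∷ p ∷ z ∷ r         ≡⟨ ++-assoc X (ℓ ∷ ys) _ ⟨
      (X ++ ℓ ∷ ys) ++ y ∷ p ∷ z ∷ r       ∎

    m<minβ : m < minL (β p σ)
    m<minβ = subst (λ b′ → m < minL b′) (sym β≡′) (minL-glb m<B′)

head-γ-minimal : ∀ {σ ℓ c} X δ → Unique σ → ¬ HasDoubleDescent σ →
  ((k : ℕ) → GoodPinnacle σ k → ℓ ≤ k) → σ ≡ X ++ ℓ ∷ c ∷ δ → c < ℓ →
  All (c ≤_) (takeWhile (_<? ℓ) δ)
head-γ-minimal {σ} {ℓ} {c} X δ u noDD minimal σ≡ c<ℓ with all≤⊎first< c (takeWhile (_<? ℓ) δ)
... | inj₁ c≤γ = c≤γ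
... | inj₂ (u′ , m , v , γ≡ , c≤u′ , m<c) with maxSplit c u′
...   | B , p , G , c∷u′≡ , B≤p , G≤p =
  ⊥-elim ([ noDD ∘ (p ,_) , <⇒≱ p<ℓ ∘ minimal p ]′
    (peak⇒doubleDescent⊎goodPinnacle X B G (v ++ D) u σ≡peak p<ℓ m<p B≤p G≤p (++⁻ˡ B m<run)))
  where
  D : List ℕ
  D = dropWhile (_<? ℓ) δ

  σ≡peak : σ ≡ X ++ ℓ ∷ B ++ p ∷ G ++ m ∷ v ++ D
  σ≡peak = begin
    σ                                              ≡⟨ σ≡ ⟩
    X ++ ℓ ∷ c ∷ δ                                 ≡⟨ cong (λ t → X ++ ℓ ∷ c ∷ t) (takeWhile++dropWhile (_<? ℓ) δ) ⟨
    X ++ ℓ ∷ c ∷ takeWhile (_<? ℓ) δ ++ D          ≡⟨ cong (λ t → X ++ ℓ ∷ c ∷ t ++ D) γ≡ ⟩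
    X ++ ℓ ∷ c ∷ (u′ ++ m ∷ v) ++ D                ≡⟨ cong (λ t → X ++ ℓ ∷ c ∷ t) (++-assoc u′ (m ∷ v) D) ⟩
    X ++ ℓ ∷ (c ∷ u′) ++ m ∷ v ++ D                ≡⟨ cong (λ t → X ++ ℓ ∷ t ++ m ∷ v ++ D) c∷u′≡ ⟩
    X ++ ℓ ∷ (B ++ p ∷ G) ++ m ∷ v ++ D            ≡⟨ cong (λ t → X ++ ℓ ∷ t) (++-assoc B (p ∷ G) _) ⟩
    X ++ ℓ ∷ B ++ p ∷ G ++ m ∷ v ++ D              ∎

  run<ℓ : All (_< ℓ) (B ++ p ∷ G)
  run<ℓ = subst (All (_< ℓ)) c∷u′≡
    (c<ℓ ∷ ++⁻ˡ u′ (subst (All (_< ℓ)) γ≡ (all-takeWhile (_<? ℓ) δ)))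

  m<run : All (m <_) (B ++ p ∷ G)
  m<run = subst (All (m <_)) c∷u′≡ (m<c ∷ All.map (<-≤-trans m<c) c≤u′)

  p<ℓ : p < ℓ
  p<ℓ = All.head (++⁻ʳ B run<ℓ)

  m<p : m < p
  m<p = All.head (++⁻ʳ B m<run)

doubleDescent⇒φ<lex : ∀ {σ b} → Unique σ → DoubleDescentAt σ b → φ b σ <lex σ
doubleDescent⇒φ<lex {σ} {b} u (α , a , c , δ , σ≡ , b<a , c<b) =
  φ-<lex (α ∷ʳ a) (c ∷ δ) u σ≡pre γ≡ c<b (subst (All (c <_)) (sym β≡) [])
  where
  σ≡pre : σ ≡ (α ∷ʳ a) ++ b ∷ c ∷ δ
  σ≡pre = trans σ≡ (sym (∷ʳ-++ α a _))

  split : splitAt b σ ≡ just (α ∷ʳ a , c ∷ δ)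
  split = splitAt-unique (α ∷ʳ a) (c ∷ δ) u σ≡pre

  β≡ : β b σ ≡ []
  β≡ = trans (β-split {σ = σ} split) (smallSuffix-++-∷ α [] (<-asym b<a) [])

  γ≡ : γ b σ ≡ c ∷ takeWhile (_<? b) δ
  γ≡ = trans (γ-split {σ = σ} split) (takeWhile-++ (_<? b) δ (c<b ∷ []))

minimalGoodPinnacle⇒φ<lex : ∀ {σ ℓ} → Unique σ → ¬ HasDoubleDescent σ → GoodPinnacle σ ℓ →
  ((k : ℕ) → GoodPinnacle σ k → ℓ ≤ k) → φ ℓ σ <lex σ
minimalGoodPinnacle⇒φ<lex {σ} {ℓ} u noDD ((α , a , c , δ , σ≡ , _ , c<ℓ) , minγ<minβ) minimal =
  φ-<lex (α ∷ʳ a) (c ∷ δ) u σ≡pre γ≡ c<ℓ (All.map (<-≤-trans c<minβ) (minL-≤ (β ℓ σ)))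
  where
  σ≡pre : σ ≡ (α ∷ʳ a) ++ ℓ ∷ c ∷ δ
  σ≡pre = trans σ≡ (sym (∷ʳ-++ α a _))

  split : splitAt ℓ σ ≡ just (α ∷ʳ a , c ∷ δ)
  split = splitAt-unique (α ∷ʳ a) (c ∷ δ) u σ≡pre

  γ≡ : γ ℓ σ ≡ c ∷ takeWhile (_<? ℓ) δ
  γ≡ = trans (γ-split {σ = σ} split) (takeWhile-++ (_<? ℓ) δ (c<ℓ ∷ []))

  c≤minγ : c ≤ minL (γ ℓ σ)
  c≤minγ = subst (λ g → c ≤ minL g) (sym γ≡)
    (minL-glb (≤-refl ∷ head-γ-minimal (α ∷ʳ a) δ u noDD minimal σ≡pre c<ℓ))

  c<minβ : c < minL (β ℓ σ)
  c<minβ = ≤-<-trans c≤minγ minγ<minβ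

mainTheorem7 : (n : ℕ) (σ : List ℕ) → IsPerm n σ →
    ((b : ℕ) → DoubleDescentAt σ b → φ b σ <lex σ) ×
    (¬ HasDoubleDescent σ → (ℓ : ℕ) → GoodPinnacle σ ℓ →
      ((k : ℕ) → GoodPinnacle σ k → ℓ ≤ k) → φ ℓ σ <lex σ)
mainTheorem7 n σ σ↭ =
  (λ _ → doubleDescent⇒φ<lex u) , λ noDD _ → minimalGoodPinnacle⇒φ<lex u noDD
  where
  u : Unique σ
  u = IsPerm⇒Unique σ↭
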